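{- Let $p\equiv 3\pmod 4$ be a prime, let $\ell$ be a prime, and let $\mathcal{O}=\mathbb{Z}+\mathbb{Z}i+\mathbb{Z}\frac{1+j}{2}+\mathbb{Z}\frac{i+k}{2}\subset B_{p,\infty}$, where $i^2=-1$, $j^2=-p$, $k=ij=-ji$. Suppose $p>4\ell^2$. $(1)$ If $\mu\in\ell^{ -1}\mathcal{O}$ satisfies $\mathrm{Nrd}(\mu)=1$ and $\mu\notin\{\pm1,\pm i\}$, then $\ell\equiv 1\pmod 4$ and $\mu=\ell^{ -1}(x+yi)$ for some $(x,y)\in\mathbb{Z}^2$ with $\ell\nmid x$ and $x^2+y^2=\ell^2$. $(2)$ If $s\in\ell^{ -1}\mathcal{O}$ satisfies $s^2=-p$ and $s\notin\{\pm j,\pm k\}$, then $\ell\equiv 1\pmod 4$ and $s=\ell^{ -1}(xj+yk)$ for some $(x,y)\in\mathbb{Z}^2$ with $\ell\nmid x$ and $x^2+y^2=\ell^2$.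
   Context: $B_{p,\infty}$ is the quaternion algebra $\mathbb{Q}+\mathbb{Q}i+\mathbb{Q}j+\mathbb{Q}k$ with $i^2=-1$, $j^2=-p$, $k=ij=-ji$; the reduced norm of $a_1+a_2i+a_3j+a_4k$ is $a_1^2+a_2^2+pa_3^2+pa_4^2$. The order $\mathcal{O}$ is the endomorphism ring of the supersingular curve $y^2=x^3+x$ over $\overline{\mathbb{F}}_p$. -}

module Defs where

open import Data.Nat using (ℕ; zero; suc)
open import Data.Integer using (ℤ; +_)
open import Data.Rational using (ℚ; _/_; _+_; _-_; _*_; -_; 0ℚ; 1ℚ)
open import Data.Product using (∃; _,_)
open import Relation.Binary.PropositionalEquality using (_≡_)

-- Elements a₁ + a₂ i + a₃ j + a₄ k of B_{p,∞} (rational coordinates).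
record ℍ : Set where
  constructor ⟨_,_,_,_⟩
  field
    c₁ c₂ c₃ c₄ : ℚ
open ℍ public

ℕ→ℚ : ℕ → ℚ
ℕ→ℚ n = (+ n) / 1

ℤ→ℚ : ℤ → ℚ
ℤ→ℚ z = z / 1

-- 1/ℓ (only used for ℓ ≥ 1; the value at 0 is an irrelevant convention)
inv : ℕ → ℚ
inv zero    = 0ℚ
inv (suc n) = (+ 1) / suc n

half : ℚ
half = (+ 1) / 2

module _ (p : ℕ) where
  private P = ℕ→ℚ p

  -- Hamilton product with jk = p i, kj = -p i, ki = j, ik = -j, k² = -p.
  mulH : ℍ → ℍ → ℍ
  mulH ⟨ a₁ , a₂ , a₃ , a₄ ⟩ ⟨ b₁ , b₂ , b₃ , b₄ ⟩ =
    ⟨ a₁ * b₁ - a₂ * b₂ - P * (a₃ * b₃) - P * (a₄ * b₄)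
    , a₁ * b₂ + a₂ * b₁ + P * (a₃ * b₄ - a₄ * b₃)
    , a₁ * b₃ + a₃ * b₁ + (a₄ * b₂ - a₂ * b₄)
    , a₁ * b₄ + a₄ * b₁ + (a₂ * b₃ - a₃ * b₂) ⟩

  Nrd : ℍ → ℚ
  Nrd ⟨ a₁ , a₂ , a₃ , a₄ ⟩ = a₁ * a₁ + a₂ * a₂ + P * (a₃ * a₃) + P * (a₄ * a₄)

scale : ℚ → ℍ → ℍ
scale r ⟨ a₁ , a₂ , a₃ , a₄ ⟩ = ⟨ r * a₁ , r * a₂ , r * a₃ , r * a₄ ⟩

qOne qI qJ qK : ℍ
qOne = ⟨ 1ℚ , 0ℚ , 0ℚ , 0ℚ ⟩
qI   = ⟨ 0ℚ , 1ℚ , 0ℚ , 0ℚ ⟩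
qJ   = ⟨ 0ℚ , 0ℚ , 1ℚ , 0ℚ ⟩
qK   = ⟨ 0ℚ , 0ℚ , 0ℚ , 1ℚ ⟩

negH : ℍ → ℍ
negH ⟨ a₁ , a₂ , a₃ , a₄ ⟩ = ⟨ - a₁ , - a₂ , - a₃ , - a₄ ⟩

scalarH : ℚ → ℍ
scalarH r = ⟨ r , 0ℚ , 0ℚ , 0ℚ ⟩

-- a + b i + c (1+j)/2 + d (i+k)/2
ordElt : ℤ → ℤ → ℤ → ℤ → ℍ
ordElt a b c d =
  ⟨ ℤ→ℚ a + ℤ→ℚ c * half
  , ℤ→ℚ b + ℤ→ℚ d * half
  , ℤ→ℚ c * half
  , ℤ→ℚ d * half ⟩

InO : ℍ → Set
InO μ = ∃ λ a → ∃ λ b → ∃ λ c → ∃ λ d → μ ≡ ordElt a b c d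

InLinvO : ℕ → ℍ → Set
InLinvO ℓ μ = ∃ λ a → ∃ λ b → ∃ λ c → ∃ λ d → μ ≡ scale (inv ℓ) (ordElt a b c d)

lin1i : ℤ → ℤ → ℍ
lin1i x y = ⟨ ℤ→ℚ x , ℤ→ℚ y , 0ℚ , 0ℚ ⟩

linjk : ℤ → ℤ → ℍ
linjk x y = ⟨ 0ℚ , 0ℚ , ℤ→ℚ x , ℤ→ℚ y ⟩

{-# OPTIONS --safe #-}
module Submission where

-- Write an element of ℓ⁻¹O as (2ℓ)⁻¹ (w₁ + w₂ i + w₃ j + w₄ k) with integers wᵢ.
-- Nrd = 1 becomes w₁² + w₂² + p (w₃² + w₄²) = 4ℓ², and p > 4ℓ² forces w₃ = w₄ = 0.
-- A square root of -p is pure (the imaginary parts of w² are 2 w₁ w₂, 2 w₁ w₃, 2 w₁ w₄),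
-- so w₂² + p (w₃² + w₄²) = 4ℓ² p; then p ∣ w₂, and p > 4ℓ² forces w₂ = 0.
-- Either way one is left with x² + y² = ℓ². Unless the element is ±1, ±i, ±j or ±k,
-- x and y are nonzero, so ℓ is odd; with x odd and ℓ = x + 2u one gets u (ℓ - u) = (y/2)²,
-- where u and ℓ - u are coprime, hence both squares: ℓ is an odd sum of two squares, ℓ ≡ 1 (mod 4).

open import Defs

module SumsOfTwoSquares where
  open import Data.Empty using (⊥-elim)
  open import Data.Nat
  open import Data.Nat.Coprimality using (Coprime; coprime-divisor; prime⇒coprime) renaming (sym to coprime-sym)
  open import Data.Nat.Divisibility
  open import Data.Nat.DivMod using (_%_; [m+kn]%n≡m%n)
  open import Data.Nat.GCD using (gcd; gcd[m,n]∣m; gcd[m,n]∣n; gcd-greatest; c*gcd[m,n]≡gcd[cm,cn])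
  open import Data.Nat.Primality using (Prime; prime⇒irreducible; prime⇒nonZero; euclidsLemma)
  open import Data.Nat.Properties
  open import Data.Nat.Tactic.RingSolver using (solve-∀)
  open import Data.Product using (∃; ∃₂; _×_; _,_)
  open import Data.Sum using (_⊎_; inj₁; inj₂; reduce)
  open import Relation.Binary.Definitions using (tri<; tri≈; tri>)
  open import Relation.Binary.PropositionalEquality
  open import Relation.Nullary using (¬_; contradiction)

  private variable k m n t x y ℓ L s : ℕ

  coprime-square : Coprime m n → Coprime (m * m) n
  coprime-square {m} m⊥n {i} (i∣m*m , i∣n) = m⊥n (coprime-divisor i⊥m i∣m*m , i∣n)
    where
    i⊥m : Coprime i m
    i⊥m (j∣i , j∣m) = m⊥n (j∣m , ∣-trans j∣i i∣n)

  -- With g = gcd m t: g² ∣ t² = m n with g² coprime to n, while g² = gcd (g m) (g t) and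
  -- g t = gcd (t m) (t t) are both divisible by m.
  coprime-*≡square⇒square : Coprime m n → m * n ≡ t * t → m ≡ gcd m t * gcd m t
  coprime-*≡square⇒square {m} {n} {t} m⊥n mn≡tt = ∣-antisym m∣g*g g*g∣m
    where
    g : ℕ
    g = gcd m t
    g⊥n : Coprime g n
    g⊥n (i∣g , i∣n) = m⊥n (∣-trans i∣g (gcd[m,n]∣m m t) , i∣n)
    g*g∣m : g * g ∣ m
    g*g∣m = coprime-divisor (coprime-square g⊥n)
      (subst (g * g ∣_) (trans (sym mn≡tt) (*-comm m n)) (*-pres-∣ (gcd[m,n]∣n m t) (gcd[m,n]∣n m t)))
    m∣t*g : m ∣ t * g
    m∣t*g = subst (m ∣_) (sym (c*gcd[m,n]≡gcd[cm,cn] t m t))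
      (gcd-greatest (n∣m*n t) (subst (m ∣_) mn≡tt (m∣m*n n)))
    m∣g*g : m ∣ g * g
    m∣g*g = subst (m ∣_) (sym (c*gcd[m,n]≡gcd[cm,cn] g m t))
      (gcd-greatest (n∣m*n g) (subst (m ∣_) (*-comm t g) m∣t*g))

  even-or-odd : ∀ n → ∃ λ k → n ≡ 2 * k ⊎ n ≡ 1 + 2 * k
  even-or-odd zero = 0 , inj₁ refl
  even-or-odd (suc n) with even-or-odd n
  ... | k , inj₁ refl = k , inj₂ refl
  ... | k , inj₂ refl = suc k , inj₁ (sym (*-distribˡ-+ 2 1 k))

  OppositeParity : ℕ → ℕ → Set
  OppositeParity m n = ∃₂ λ i j → m ≡ 2 * i × n ≡ 1 + 2 * j

  odd-sum-of-squares⇒opposite-parity :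
    m * m + n * n ≡ 1 + 2 * k → OppositeParity m n ⊎ OppositeParity n m
  odd-sum-of-squares⇒opposite-parity {m} {n} {k} e with even-or-odd m | even-or-odd n
  ... | i , inj₁ refl | j , inj₂ refl = inj₁ (i , j , refl , refl)
  ... | i , inj₂ refl | j , inj₁ refl = inj₂ (j , i , refl , refl)
  ... | i , inj₁ refl | j , inj₁ refl = ⊥-elim (even≢odd (2 * (i * i + j * j)) k (trans (evens i j) e))
    where
    evens : ∀ i j → 2 * (2 * (i * i + j * j)) ≡ 2 * i * (2 * i) + 2 * j * (2 * j)
    evens = solve-∀
  ... | i , inj₂ refl | j , inj₂ refl = ⊥-elim (even≢odd (1 + 2 * (i * i + i + j * j + j)) k (trans (odds i j) e))
    where
    odds : ∀ i j → 2 * (1 + 2 * (i * i + i + j * j + j)) ≡ (1 + 2 * i) * (1 + 2 * i) + (1 + 2 * j) * (1 + 2 * j)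
    odds = solve-∀

  even²+odd²%4≡1 : ∀ i j → (2 * i * (2 * i) + (1 + 2 * j) * (1 + 2 * j)) % 4 ≡ 1
  even²+odd²%4≡1 i j = trans (cong (_% 4) (expand i j)) ([m+kn]%n≡m%n 1 (i * i + j * j + j) 4)
    where
    expand : ∀ i j → 2 * i * (2 * i) + (1 + 2 * j) * (1 + 2 * j) ≡ 1 + (i * i + j * j + j) * 4
    expand = solve-∀

  odd-sum-of-squares%4≡1 : m * m + n * n ≡ 1 + 2 * k → (m * m + n * n) % 4 ≡ 1
  odd-sum-of-squares%4≡1 {m} {n} {k} e with odd-sum-of-squares⇒opposite-parity {m} {n} {k} e
  ... | inj₁ (i , j , refl , refl) = even²+odd²%4≡1 i j
  ... | inj₂ (i , j , refl , refl) = trans (cong (_% 4) (+-comm ((1 + 2 * j) * (1 + 2 * j)) _)) (even²+odd²%4≡1 i j)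

  *-self≡0⇒≡0 : m * m ≡ 0 → m ≡ 0
  *-self≡0⇒≡0 {m} e = reduce (m*n≡0⇒m≡0∨n≡0 m e)

  *-self-injective : m * m ≡ n * n → m ≡ n
  *-self-injective {m} {n} e with <-cmp m n
  ... | tri< m<n _ _ = contradiction e (<⇒≢ (*-mono-< m<n m<n))
  ... | tri≈ _ m≡n _ = m≡n
  ... | tri> _ _ n<m = contradiction (sym e) (<⇒≢ (*-mono-< n<m n<m))

  2*n≢0 : n ≢ 0 → 2 * n ≢ 0
  2*n≢0 {zero} n≢0 = ⊥-elim (n≢0 refl)
  2*n≢0 {suc n} _ = λ ()

  leg<hypotenuse : x * x + y * y ≡ ℓ * ℓ → y ≢ 0 → x < ℓ
  leg<hypotenuse {x} {y} {ℓ} e y≢0 = ≰⇒> λ ℓ≤x → y≢0 (*-self≡0⇒≡0 (n≤0⇒n≡0 (+-cancelˡ-≤ (x * x) (y * y) 0 (begin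
    x * x + y * y ≡⟨ e ⟩
    ℓ * ℓ         ≤⟨ *-mono-≤ ℓ≤x ℓ≤x ⟩
    x * x         ≡⟨ +-identityʳ (x * x) ⟨
    x * x + 0     ∎))))
    where open ≤-Reasoning

  no-positive-legs-over-2 : x < 2 → y < 2 → x ≢ 0 → y ≢ 0 → x * x + y * y ≢ 2 * 2
  no-positive-legs-over-2 {zero} _ _ x≢0 _ = ⊥-elim (x≢0 refl)
  no-positive-legs-over-2 {_} {zero} _ _ _ y≢0 = ⊥-elim (y≢0 refl)
  no-positive-legs-over-2 {1} {1} _ _ _ _ = λ ()
  no-positive-legs-over-2 {suc (suc _)} (s≤s (s≤s ()))
  no-positive-legs-over-2 {1} {suc (suc _)} _ (s≤s (s≤s ()))

  -- With ℓ = 1 + 2 (s + u), the summands of ℓ = u + v, v = u + (1 + 2s), satisfy u v = t².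
  odd-leg⇒hypotenuse%4≡1 : Prime ℓ → ℓ ≡ 1 + 2 * L →
    (1 + 2 * s) * (1 + 2 * s) + 2 * t * (2 * t) ≡ ℓ * ℓ → t ≢ 0 → ℓ % 4 ≡ 1
  odd-leg⇒hypotenuse%4≡1 {ℓ} {L} {s} {t} pℓ refl e t≢0
    with m≤n⇒∃[o]m+o≡n (*-cancelˡ-< 2 s L (s<s⁻¹ (leg<hypotenuse e (2*n≢0 t≢0))))
  ... | o , refl =
    subst (λ n → n % 4 ≡ 1) (sym ℓ≡g²+h²) (odd-sum-of-squares%4≡1 {gcd u t} {gcd v t} {suc s + o} (sym ℓ≡g²+h²))
    where
    u v : ℕ
    u = suc o
    v = u + (1 + 2 * s)
    u+v≡ℓ : u + v ≡ 1 + 2 * (suc s + o)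
    u+v≡ℓ = expand s o
      where
      expand : ∀ s o → suc o + (suc o + (1 + 2 * s)) ≡ 1 + 2 * (suc s + o)
      expand = solve-∀
    u*v≡t*t : u * v ≡ t * t
    u*v≡t*t = *-cancelˡ-≡ (u * v) (t * t) 4 (+-cancelˡ-≡ ((1 + 2 * s) * (1 + 2 * s)) _ _
      (trans (expandℓ s o) (trans (sym e) (expandt s t))))
      where
      expandℓ : ∀ s o → (1 + 2 * s) * (1 + 2 * s) + 4 * (suc o * (suc o + (1 + 2 * s)))
                          ≡ (1 + 2 * (suc s + o)) * (1 + 2 * (suc s + o))
      expandℓ = solve-∀
      expandt : ∀ s t → (1 + 2 * s) * (1 + 2 * s) + 2 * t * (2 * t) ≡ (1 + 2 * s) * (1 + 2 * s) + 4 * (t * t)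
      expandt = solve-∀
    u⊥v : Coprime u v
    u⊥v {d} (d∣u , d∣v) = prime⇒coprime pℓ u<ℓ (subst (d ∣_) u+v≡ℓ (∣m∣n⇒∣m+n d∣u d∣v) , d∣u)
      where
      u<ℓ : u < 1 + 2 * (suc s + o)
      u<ℓ = subst (u <_) u+v≡ℓ (m<m+n u (s≤s z≤n))
    ℓ≡g²+h² : 1 + 2 * (suc s + o) ≡ gcd u t * gcd u t + gcd v t * gcd v t
    ℓ≡g²+h² = trans (sym u+v≡ℓ) (cong₂ _+_
      (coprime-*≡square⇒square {t = t} u⊥v u*v≡t*t)
      (coprime-*≡square⇒square {t = t} (coprime-sym u⊥v) (trans (*-comm v u) u*v≡t*t)))

  prime-hypotenuse%4≡1 : Prime ℓ → x * x + y * y ≡ ℓ * ℓ → x ≢ 0 → y ≢ 0 → ℓ % 4 ≡ 1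
  prime-hypotenuse%4≡1 {ℓ} {x} {y} pℓ e x≢0 y≢0 with even-or-odd ℓ
  ... | L , inj₁ ℓ≡2L with prime⇒irreducible pℓ (divides L (trans ℓ≡2L (*-comm 2 L)))
  ...   | inj₁ ()
  ...   | inj₂ refl = ⊥-elim (no-positive-legs-over-2 x<2 y<2 x≢0 y≢0 e)
    where
    x<2 : x < 2
    x<2 = leg<hypotenuse e y≢0
    y<2 : y < 2
    y<2 = leg<hypotenuse (trans (+-comm (y * y) (x * x)) e) x≢0
  prime-hypotenuse%4≡1 {ℓ} {x} {y} pℓ e x≢0 y≢0 | L , inj₂ ℓ≡1+2L
    with odd-sum-of-squares⇒opposite-parity {x} {y} {2 * (L * L + L)} (trans e (square-odd ℓ≡1+2L))
    where
    square-odd : ℓ ≡ 1 + 2 * L → ℓ * ℓ ≡ 1 + 2 * (2 * (L * L + L))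
    square-odd refl = expand L
      where
      expand : ∀ L → (1 + 2 * L) * (1 + 2 * L) ≡ 1 + 2 * (2 * (L * L + L))
      expand = solve-∀
  ... | inj₁ (i , j , refl , refl) = odd-leg⇒hypotenuse%4≡1 {L = L} {s = j} {t = i} pℓ ℓ≡1+2L
    (trans (+-comm _ (2 * i * (2 * i))) e) (λ { refl → x≢0 refl })
  ... | inj₂ (i , j , refl , refl) = odd-leg⇒hypotenuse%4≡1 {L = L} {s = j} {t = i} pℓ ℓ≡1+2L
    e (λ { refl → y≢0 refl })

  prime-hypotenuse∤leg : x * x + y * y ≡ ℓ * ℓ → x ≢ 0 → y ≢ 0 → ¬ ℓ ∣ x
  prime-hypotenuse∤leg e x≢0 y≢0 ℓ∣x = <⇒≱ (leg<hypotenuse e y≢0) (∣⇒≤ {{≢-nonZero x≢0}} ℓ∣x)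

  m+n*o<n⇒o≡0 : ∀ m n o → m + n * o < n → o ≡ 0
  m+n*o<n⇒o≡0 m n zero    _ = refl
  m+n*o<n⇒o≡0 m n (suc o) h = ⊥-elim (<⇒≱ h (≤-trans (m≤m*n n (suc o)) (m≤n+m (n * suc o) m)))

  -- p divides m², hence m; writing m = q p, the equation becomes k + p q² = n < p.
  m*m+p*k≡n*p⇒m≡0∧k≡n : ∀ {m k n p} → Prime p → n < p → m * m + p * k ≡ n * p → m ≡ 0 × k ≡ n
  m*m+p*k≡n*p⇒m≡0∧k≡n {m} {k} {n} {p} pp n<p e with reduce (euclidsLemma m m pp p∣m*m)
    where
    p∣m*m : p ∣ m * m
    p∣m*m = ∣m+n∣m⇒∣n (subst (p ∣_) (trans (sym e) (+-comm (m * m) (p * k))) (n∣m*n n)) (m∣m*n k)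
  ... | divides q refl = cong (_* p) q≡0 , k≡n
    where
    instance _ = prime⇒nonZero pp
    k+p*q²≡n : k + p * (q * q) ≡ n
    k+p*q²≡n = *-cancelʳ-≡ _ n p (trans (regroup k p q) e)
      where
      regroup : ∀ k p q → (k + p * (q * q)) * p ≡ q * p * (q * p) + p * k
      regroup = solve-∀
    q≡0 : q ≡ 0
    q≡0 = *-self≡0⇒≡0 (m+n*o<n⇒o≡0 k p (q * q) (subst (_< p) (sym k+p*q²≡n) n<p))
    k≡n : k ≡ n
    k≡n = trans (sym (trans (cong (k +_) (*-zeroʳ p)) (+-identityʳ k)))
      (subst (λ q → k + p * (q * q) ≡ n) q≡0 k+p*q²≡n)

module IntegerSumsOfTwoSquares where
  open SumsOfTwoSquares using (*-self≡0⇒≡0; *-self-injective; prime-hypotenuse%4≡1; prime-hypotenuse∤leg)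
  open import Data.Integer
  open import Data.Integer.Properties
  open import Data.Integer.Divisibility using (_∣_)
  import Data.Nat as ℕ
  open import Data.Nat.Primality using (Prime)
  open import Data.Product using (_×_; _,_)
  open import Data.Sum using (_⊎_; inj₁; inj₂)
  open import Relation.Binary.PropositionalEquality
  open import Relation.Nullary using (¬_; yes; no)

  private variable
    m ℓ : ℕ.ℕ
    x y : ℤ

  ∣_∣² : ℤ → ℕ.ℕ
  ∣ x ∣² = ∣ x ∣ ℕ.* ∣ x ∣

  *-self≡+∣∣² : ∀ x → x * x ≡ + ∣ x ∣²
  *-self≡+∣∣² (+ n)    = sym (pos-* n n)
  *-self≡+∣∣² -[1+ n ] = refl

  ∣∣²≡0⇒≡0 : ∣ x ∣² ≡ 0 → x ≡ 0ℤ
  ∣∣²≡0⇒≡0 e = ∣i∣≡0⇒i≡0 (*-self≡0⇒≡0 e)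

  sum-of-squares-abs : x * x + y * y ≡ + m → ∣ x ∣² ℕ.+ ∣ y ∣² ≡ m
  sum-of-squares-abs {x} {y} e =
    +-injective (trans (pos-+ ∣ x ∣² ∣ y ∣²) (trans (sym (cong₂ _+_ (*-self≡+∣∣² x) (*-self≡+∣∣² y))) e))

  _≡±_ : ℤ → ℕ.ℕ → Set
  x ≡± ℓ = x ≡ + ℓ ⊎ x ≡ - + ℓ

  *-self≡ℓ²⇒≡±ℓ : x * x ≡ + ℓ * + ℓ → x ≡± ℓ
  *-self≡ℓ²⇒≡±ℓ {x} {ℓ} e
    with *-self-injective {∣ x ∣} {ℓ} (+-injective (trans (sym (*-self≡+∣∣² x)) (trans e (sym (pos-* ℓ ℓ)))))
  *-self≡ℓ²⇒≡±ℓ {+ _}      _ | refl = inj₁ refl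
  *-self≡ℓ²⇒≡±ℓ { -[1+ _ ]} _ | refl = inj₂ refl

  prime-hypotenuse-cases : Prime ℓ → x * x + y * y ≡ + ℓ * + ℓ →
    (x ≡± ℓ × y ≡ 0ℤ) ⊎ (x ≡ 0ℤ × y ≡± ℓ) ⊎ (ℓ ℕ.% 4 ≡ 1 × ¬ (+ ℓ ∣ x))
  prime-hypotenuse-cases {ℓ} {x} {y} pℓ e with x ≟ 0ℤ | y ≟ 0ℤ
  ... | _ | yes refl = inj₁ (*-self≡ℓ²⇒≡±ℓ (trans (sym (+-identityʳ (x * x))) e) , refl)
  ... | yes refl | _ = inj₂ (inj₁ (refl , *-self≡ℓ²⇒≡±ℓ (trans (sym (+-identityˡ (y * y))) e)))
  ... | no x≢0 | no y≢0 =
    inj₂ (inj₂ (prime-hypotenuse%4≡1 pℓ e′ ∣x∣≢0 ∣y∣≢0 , prime-hypotenuse∤leg e′ ∣x∣≢0 ∣y∣≢0))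
    where
    e′ : ∣ x ∣² ℕ.+ ∣ y ∣² ≡ ℓ ℕ.* ℓ
    e′ = sum-of-squares-abs {x} {y} (trans e (sym (pos-* ℓ ℓ)))
    ∣x∣≢0 : ∣ x ∣ ≢ 0
    ∣x∣≢0 ∣x∣≡0 = x≢0 (∣i∣≡0⇒i≡0 ∣x∣≡0)
    ∣y∣≢0 : ∣ y ∣ ≢ 0
    ∣y∣≢0 ∣y∣≡0 = y≢0 (∣i∣≡0⇒i≡0 ∣y∣≡0)

module IntegerQuaternions where
  open SumsOfTwoSquares using (m+n*o<n⇒o≡0; m*m+p*k≡n*p⇒m≡0∧k≡n)
  open IntegerSumsOfTwoSquares using (∣_∣²; *-self≡+∣∣²; ∣∣²≡0⇒≡0)
  open import Algebra.Bundles using (AbelianGroup)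
  open import Data.Integer
  open import Data.Integer.Properties
  open import Algebra.Properties.Group (AbelianGroup.group +-0-abelianGroup) using (inverseʳ-unique)
  open import Data.Empty using (⊥-elim)
  open import Data.Integer.Tactic.RingSolver using (solve-∀)
  import Data.Nat as ℕ
  import Data.Nat.Properties as ℕ
  open import Data.Nat.Primality using (Prime)
  open import Data.Product using (_×_; _,_; proj₁; proj₂)
  open import Data.Sum using (_⊎_; inj₁; inj₂)
  open import Relation.Binary.PropositionalEquality
  open import Relation.Nullary using (yes; no)

  private variable n : ℕ.ℕ

  record ℍℤ : Set where
    constructor ⟪_,_,_,_⟫
    field
      w₁ w₂ w₃ w₄ : ℤ

  module _ (p : ℕ.ℕ) where
    private P = + p

    nrdℤ : ℍℤ → ℤ
    nrdℤ ⟪ a₁ , a₂ , a₃ , a₄ ⟫ = a₁ * a₁ + a₂ * a₂ + P * (a₃ * a₃) + P * (a₄ * a₄)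

    mulℤ : ℍℤ → ℍℤ → ℍℤ
    mulℤ ⟪ a₁ , a₂ , a₃ , a₄ ⟫ ⟪ b₁ , b₂ , b₃ , b₄ ⟫ =
      ⟪ a₁ * b₁ - a₂ * b₂ - P * (a₃ * b₃) - P * (a₄ * b₄)
      , a₁ * b₂ + a₂ * b₁ + P * (a₃ * b₄ - a₄ * b₃)
      , a₁ * b₃ + a₃ * b₁ + (a₄ * b₂ - a₂ * b₄)
      , a₁ * b₄ + a₄ * b₁ + (a₂ * b₃ - a₃ * b₂) ⟫

  -- The coordinates of 2 (a + b i + c (1+j)/2 + d (i+k)/2) in the basis 1, i, j, k.
  double-ordElt : ℤ → ℤ → ℤ → ℤ → ℍℤ
  double-ordElt a b c d = ⟪ + 2 * a + c , + 2 * b + d , c , d ⟫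

  nrdℤ≡+ : ∀ p a b c d → nrdℤ p ⟪ a , b , c , d ⟫ ≡ + (∣ a ∣² ℕ.+ ∣ b ∣² ℕ.+ p ℕ.* ∣ c ∣² ℕ.+ p ℕ.* ∣ d ∣²)
  nrdℤ≡+ p a b c d = trans
    (cong₂ _+_ (cong₂ _+_ (cong₂ _+_ (*-self≡+∣∣² a) (*-self≡+∣∣² b)) (cong (+ p *_) (*-self≡+∣∣² c)))
               (cong (+ p *_) (*-self≡+∣∣² d)))
    (sym (trans (pos-+ (∣ a ∣² ℕ.+ ∣ b ∣² ℕ.+ p ℕ.* ∣ c ∣²) (p ℕ.* ∣ d ∣²))
      (cong₂ _+_ (trans (pos-+ (∣ a ∣² ℕ.+ ∣ b ∣²) (p ℕ.* ∣ c ∣²))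
                        (cong₂ _+_ (pos-+ ∣ a ∣² ∣ b ∣²) (pos-* p ∣ c ∣²)))
                 (pos-* p ∣ d ∣²))))

  nrdℤ<p⇒∈ℤ+ℤi : ∀ p a b c d → nrdℤ p ⟪ a , b , c , d ⟫ ≡ + n → n ℕ.< p → c ≡ 0ℤ × d ≡ 0ℤ
  nrdℤ<p⇒∈ℤ+ℤi p a b c d e n<p =
    ∣∣²≡0⇒≡0 (m+n*o<n⇒o≡0 (∣ a ∣² ℕ.+ ∣ b ∣²) p ∣ c ∣² (ℕ.≤-<-trans (ℕ.m≤m+n _ (p ℕ.* ∣ d ∣²)) bound)) ,
    ∣∣²≡0⇒≡0 (m+n*o<n⇒o≡0 (∣ a ∣² ℕ.+ ∣ b ∣² ℕ.+ p ℕ.* ∣ c ∣²) p ∣ d ∣² bound)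
    where
    bound : ∣ a ∣² ℕ.+ ∣ b ∣² ℕ.+ p ℕ.* ∣ c ∣² ℕ.+ p ℕ.* ∣ d ∣² ℕ.< p
    bound = subst (ℕ._< p) (+-injective (trans (sym e) (nrdℤ≡+ p a b c d))) n<p

  +m≡-+n⇒m≡0 : ∀ {m n} → + m ≡ - + n → m ≡ 0
  +m≡-+n⇒m≡0 {n = ℕ.zero} e = +-injective e

  2*x≡0⇒x≡0 : ∀ x → + 2 * x ≡ 0ℤ → x ≡ 0ℤ
  2*x≡0⇒x≡0 x e with i*j≡0⇒i≡0∨j≡0 (+ 2) e
  ... | inj₂ x≡0 = x≡0

  square-scalar⇒pure-or-scalar : ∀ {r} p a b c d →
    mulℤ p ⟪ a , b , c , d ⟫ ⟪ a , b , c , d ⟫ ≡ ⟪ r , 0ℤ , 0ℤ , 0ℤ ⟫ → a ≡ 0ℤ ⊎ (b ≡ 0ℤ × c ≡ 0ℤ × d ≡ 0ℤ)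
  square-scalar⇒pure-or-scalar p a b c d e with a ≟ 0ℤ
  ... | yes a≡0 = inj₁ a≡0
  ... | no a≢0 = inj₂ (cancel-a (trans (sym (twice-i (+ p) a b c d)) (cong ℍℤ.w₂ e)) ,
                       cancel-a (trans (sym (twice-j a b c d)) (cong ℍℤ.w₃ e)) ,
                       cancel-a (trans (sym (twice-k a b c d)) (cong ℍℤ.w₄ e)))
    where
    cancel-a : ∀ {x} → + 2 * (a * x) ≡ 0ℤ → x ≡ 0ℤ
    cancel-a {x} e with i*j≡0⇒i≡0∨j≡0 a (2*x≡0⇒x≡0 (a * x) e)
    ... | inj₁ a≡0 = ⊥-elim (a≢0 a≡0)
    ... | inj₂ x≡0 = x≡0
    twice-i : ∀ P a b c d → a * b + b * a + P * (c * d - d * c) ≡ + 2 * (a * b)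
    twice-i = solve-∀
    twice-j : ∀ a b c d → a * c + c * a + (d * b - b * d) ≡ + 2 * (a * c)
    twice-j = solve-∀
    twice-k : ∀ a b c d → a * d + d * a + (b * c - c * b) ≡ + 2 * (a * d)
    twice-k = solve-∀

  square≡-n⇒pure : ∀ p a b c d →
    mulℤ p ⟪ a , b , c , d ⟫ ⟪ a , b , c , d ⟫ ≡ ⟪ - + n , 0ℤ , 0ℤ , 0ℤ ⟫ → a ≡ 0ℤ
  square≡-n⇒pure p a b c d e with square-scalar⇒pure-or-scalar p a b c d e
  ... | inj₁ a≡0 = a≡0
  ... | inj₂ (refl , refl , refl) =
    ∣∣²≡0⇒≡0 (+m≡-+n⇒m≡0 (trans (sym (*-self≡+∣∣² a)) (trans (drop-zeros a (+ p)) (cong ℍℤ.w₁ e))))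
    where
    drop-zeros : ∀ a P → a * a ≡ a * a - 0ℤ * 0ℤ - P * (0ℤ * 0ℤ) - P * (0ℤ * 0ℤ)
    drop-zeros = solve-∀

  square≡-n*p⇒∈ℤj+ℤk : ∀ {n} p a b c d → Prime p → n ℕ.< p →
    mulℤ p ⟪ a , b , c , d ⟫ ⟪ a , b , c , d ⟫ ≡ ⟪ - + (n ℕ.* p) , 0ℤ , 0ℤ , 0ℤ ⟫ →
    a ≡ 0ℤ × b ≡ 0ℤ × c * c + d * d ≡ + n
  square≡-n*p⇒∈ℤj+ℤk {n} p a b c d pp n<p e with square≡-n⇒pure p a b c d e
  ... | refl = refl , ∣i∣≡0⇒i≡0 (proj₁ factored) ,
    trans (cong₂ _+_ (*-self≡+∣∣² c) (*-self≡+∣∣² d)) (trans (sym (pos-+ ∣ c ∣² ∣ d ∣²)) (cong +_ (proj₂ factored)))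
    where
    minus-nrd : ∀ P b c d →
      0ℤ * 0ℤ - b * b - P * (c * c) - P * (d * d) ≡ - (0ℤ * 0ℤ + b * b + P * (c * c) + P * (d * d))
    minus-nrd = solve-∀
    nrd≡n*p : ∣ b ∣² ℕ.+ p ℕ.* (∣ c ∣² ℕ.+ ∣ d ∣²) ≡ n ℕ.* p
    nrd≡n*p = trans (trans (cong (∣ b ∣² ℕ.+_) (ℕ.*-distribˡ-+ p ∣ c ∣² ∣ d ∣²)) (sym (ℕ.+-assoc ∣ b ∣² _ _)))
      (+-injective (trans (sym (nrdℤ≡+ p 0ℤ b c d))
        (neg-injective (trans (sym (minus-nrd (+ p) b c d)) (cong ℍℤ.w₁ e)))))
    factored : ∣ b ∣ ≡ 0 × ∣ c ∣² ℕ.+ ∣ d ∣² ≡ n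
    factored = m*m+p*k≡n*p⇒m≡0∧k≡n pp n<p nrd≡n*p

  +4ℓ² : ∀ ℓ → + (4 ℕ.* (ℓ ℕ.* ℓ)) ≡ + 4 * (+ ℓ * + ℓ)
  +4ℓ² ℓ = trans (pos-* 4 (ℓ ℕ.* ℓ)) (cong (+ 4 *_) (pos-* ℓ ℓ))

  2ℓ*2ℓ≡4ℓ² : ∀ ℓ → (+ 2 * + ℓ) * (+ 2 * + ℓ) ≡ + (4 ℕ.* (ℓ ℕ.* ℓ))
  2ℓ*2ℓ≡4ℓ² ℓ = trans (expand (+ ℓ)) (sym (+4ℓ² ℓ))
    where
    expand : ∀ L → (+ 2 * L) * (+ 2 * L) ≡ + 4 * (L * L)
    expand = solve-∀

  2ℓ*2ℓ*-p≡-4ℓ²p : ∀ ℓ p → (+ 2 * + ℓ) * (+ 2 * + ℓ) * - + p ≡ - + (4 ℕ.* (ℓ ℕ.* ℓ) ℕ.* p)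
  2ℓ*2ℓ*-p≡-4ℓ²p ℓ p = trans (cong (_* - + p) (2ℓ*2ℓ≡4ℓ² ℓ))
    (trans (sym (neg-distribʳ-* (+ (4 ℕ.* (ℓ ℕ.* ℓ))) (+ p))) (cong -_ (sym (pos-* (4 ℕ.* (ℓ ℕ.* ℓ)) p))))

  double-ordElt-norm≡4ℓ² : ∀ p ℓ a b c d → 4 ℕ.* (ℓ ℕ.* ℓ) ℕ.< p →
    nrdℤ p (double-ordElt a b c d) ≡ + (4 ℕ.* (ℓ ℕ.* ℓ)) → c ≡ 0ℤ × d ≡ 0ℤ × a * a + b * b ≡ + ℓ * + ℓ
  double-ordElt-norm≡4ℓ² p ℓ a b c d bound e
    with nrdℤ<p⇒∈ℤ+ℤi p (+ 2 * a + c) (+ 2 * b + d) c d e bound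
  ... | refl , refl = refl , refl , *-cancelˡ-≡ (+ 4) _ _ (trans (sym (expand (+ p) a b)) (trans e (+4ℓ² ℓ)))
    where
    expand : ∀ P a b →
      (+ 2 * a + 0ℤ) * (+ 2 * a + 0ℤ) + (+ 2 * b + 0ℤ) * (+ 2 * b + 0ℤ) + P * (0ℤ * 0ℤ) + P * (0ℤ * 0ℤ)
        ≡ + 4 * (a * a + b * b)
    expand = solve-∀

  double-ordElt-square≡-4ℓ²p : ∀ p ℓ a b c d → Prime p → 4 ℕ.* (ℓ ℕ.* ℓ) ℕ.< p →
    mulℤ p (double-ordElt a b c d) (double-ordElt a b c d) ≡ ⟪ - + (4 ℕ.* (ℓ ℕ.* ℓ) ℕ.* p) , 0ℤ , 0ℤ , 0ℤ ⟫ →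
    c ≡ - (+ 2 * a) × d ≡ - (+ 2 * b) × - a * - a + - b * - b ≡ + ℓ * + ℓ
  double-ordElt-square≡-4ℓ²p p ℓ a b c d pp bound e
    with square≡-n*p⇒∈ℤj+ℤk p (+ 2 * a + c) (+ 2 * b + d) c d pp bound e
  ... | 2a+c≡0 , 2b+d≡0 , c²+d²≡4ℓ² with inverseʳ-unique (+ 2 * a) c 2a+c≡0 | inverseʳ-unique (+ 2 * b) d 2b+d≡0
  ...   | refl | refl = refl , refl , *-cancelˡ-≡ (+ 4) _ _ (trans (sym (expand a b)) (trans c²+d²≡4ℓ² (+4ℓ² ℓ)))
    where
    expand : ∀ a b → - (+ 2 * a) * - (+ 2 * a) + - (+ 2 * b) * - (+ 2 * b) ≡ + 4 * (- a * - a + - b * - b)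
    expand = solve-∀

module RationalQuaternions where
  open IntegerSumsOfTwoSquares using (_≡±_)
  open IntegerQuaternions using (ℍℤ; ⟪_,_,_,_⟫; nrdℤ; mulℤ; double-ordElt; 2ℓ*2ℓ≡4ℓ²; 2ℓ*2ℓ*-p≡-4ℓ²p)
  import Data.Integer as ℤ
  open import Data.Integer using (ℤ; +_; 0ℤ)
  import Data.Integer.Properties as ℤ
  open import Data.Integer.Tactic.RingSolver using () renaming (solve-∀ to ℤ-solve-∀)
  open import Data.Nat using (ℕ; suc; NonZero)
  import Data.Nat as ℕ
  import Data.Nat.Properties as ℕ
  open import Data.Rational using (ℚ; 0ℚ; 1ℚ; _+_; _*_; _-_; -_; toℚᵘ)
  import Data.Rational.Properties as ℚ
  open import Data.Rational.Unnormalised using (mkℚᵘ; *≡*) renaming (_≃_ to _≃ᵘ_)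
  import Data.Rational.Unnormalised.Properties as ℚᵘ
  open import Data.Sum using (_⊎_; inj₁; inj₂)
  open import Level using (0ℓ)
  open import Relation.Binary.PropositionalEquality
  open import Relation.Nullary.Decidable using (dec⇒maybe)
  open import Tactic.RingSolver using (solve-∀)
  open import Tactic.RingSolver.Core.AlmostCommutativeRing using (AlmostCommutativeRing; fromCommutativeRing)

  ℚ-ring : AlmostCommutativeRing 0ℓ 0ℓ
  ℚ-ring = fromCommutativeRing ℚ.+-*-commutativeRing (λ q → dec⇒maybe (0ℚ ℚ.≟ q))

  toℚᵘ-ℤ→ℚ : ∀ z → toℚᵘ (ℤ→ℚ z) ≃ᵘ mkℚᵘ z 0
  toℚᵘ-ℤ→ℚ z = ℚ.toℚᵘ-fromℚᵘ (mkℚᵘ z 0)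

  ℤ→ℚ-homo-+ : ∀ x y → ℤ→ℚ (x ℤ.+ y) ≡ ℤ→ℚ x + ℤ→ℚ y
  ℤ→ℚ-homo-+ x y = ℚ.toℚᵘ-injective (ℚᵘ.≃-trans (toℚᵘ-ℤ→ℚ (x ℤ.+ y)) (ℚᵘ.≃-sym (ℚᵘ.≃-trans
    (ℚ.toℚᵘ-homo-+ (ℤ→ℚ x) (ℤ→ℚ y))
    (ℚᵘ.≃-trans (ℚᵘ.+-cong (toℚᵘ-ℤ→ℚ x) (toℚᵘ-ℤ→ℚ y)) (*≡* (expand x y))))))
    where
    expand : ∀ x y → (x ℤ.* + 1 ℤ.+ y ℤ.* + 1) ℤ.* + 1 ≡ (x ℤ.+ y) ℤ.* + 1
    expand = ℤ-solve-∀

  ℤ→ℚ-homo-* : ∀ x y → ℤ→ℚ (x ℤ.* y) ≡ ℤ→ℚ x * ℤ→ℚ y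
  ℤ→ℚ-homo-* x y = ℚ.toℚᵘ-injective (ℚᵘ.≃-trans (toℚᵘ-ℤ→ℚ (x ℤ.* y)) (ℚᵘ.≃-sym (ℚᵘ.≃-trans
    (ℚ.toℚᵘ-homo-* (ℤ→ℚ x) (ℤ→ℚ y))
    (ℚᵘ.*-cong (toℚᵘ-ℤ→ℚ x) (toℚᵘ-ℤ→ℚ y)))))

  ℤ→ℚ-homo‿- : ∀ x → ℤ→ℚ (ℤ.- x) ≡ - ℤ→ℚ x
  ℤ→ℚ-homo‿- x = ℚ.toℚᵘ-injective (ℚᵘ.≃-trans (toℚᵘ-ℤ→ℚ (ℤ.- x)) (ℚᵘ.≃-sym (ℚᵘ.≃-trans
    (ℚ.toℚᵘ-homo‿- (ℤ→ℚ x))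
    (ℚᵘ.-‿cong (toℚᵘ-ℤ→ℚ x)))))

  ℤ→ℚ-homo-− : ∀ x y → ℤ→ℚ (x ℤ.- y) ≡ ℤ→ℚ x - ℤ→ℚ y
  ℤ→ℚ-homo-− x y = trans (ℤ→ℚ-homo-+ x (ℤ.- y)) (cong (_+_ (ℤ→ℚ x)) (ℤ→ℚ-homo‿- y))

  ℤ→ℚ-injective : ∀ {x y} → ℤ→ℚ x ≡ ℤ→ℚ y → x ≡ y
  ℤ→ℚ-injective {x} {y} e
    with ℚᵘ.≃-trans (ℚᵘ.≃-sym (toℚᵘ-ℤ→ℚ x)) (ℚᵘ.≃-trans (ℚ.toℚᵘ-cong e) (toℚᵘ-ℤ→ℚ y))
  ... | *≡* x*1≡y*1 = ℤ.*-cancelʳ-≡ x y (+ 1) x*1≡y*1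

  inv*ℓ≡1 : ∀ ℓ .{{_ : NonZero ℓ}} → inv ℓ * ℤ→ℚ (+ ℓ) ≡ 1ℚ
  inv*ℓ≡1 (suc n) = ℚ.toℚᵘ-injective (ℚᵘ.≃-trans (ℚ.toℚᵘ-homo-* (inv (suc n)) (ℤ→ℚ (+ suc n)))
    (ℚᵘ.≃-trans (ℚᵘ.*-cong (ℚ.toℚᵘ-fromℚᵘ (mkℚᵘ (+ 1) n)) (toℚᵘ-ℤ→ℚ (+ suc n)))
      (*≡* (trans (ℤ.*-identityʳ _) (trans (ℤ.*-identityˡ _)
        (sym (trans (ℤ.*-identityˡ _) (cong +_ (ℕ.*-identityʳ (suc n))))))))))

  inv*ℓ≡±1 : ∀ {ℓ x} .{{_ : NonZero ℓ}} → x ≡± ℓ → inv ℓ * ℤ→ℚ x ≡ 1ℚ ⊎ inv ℓ * ℤ→ℚ x ≡ - 1ℚ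
  inv*ℓ≡±1 {ℓ} (inj₁ refl) = inj₁ (inv*ℓ≡1 ℓ)
  inv*ℓ≡±1 {ℓ} (inj₂ refl) = inj₂ (begin
    inv ℓ * ℤ→ℚ (ℤ.- + ℓ) ≡⟨ cong (inv ℓ *_) (ℤ→ℚ-homo‿- (+ ℓ)) ⟩
    inv ℓ * - ℤ→ℚ (+ ℓ)   ≡⟨ ℚ.neg-distribʳ-* (inv ℓ) (ℤ→ℚ (+ ℓ)) ⟨
    - (inv ℓ * ℤ→ℚ (+ ℓ)) ≡⟨ cong -_ (inv*ℓ≡1 ℓ) ⟩
    - 1ℚ                  ∎)
    where open ≡-Reasoning

  -- Unification cannot see through ℤ→ℚ, so its commutation with ring expressions is proved once,
  -- for a syntax of such expressions.
  infixl 6 _⊕_ _⊖_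
  infixl 7 _⊗_
  infix 8 `_

  data Poly : Set where
    `_ : ℤ → Poly
    _⊕_ _⊖_ _⊗_ : Poly → Poly → Poly

  ⟦_⟧ℤ : Poly → ℤ
  ⟦ ` z ⟧ℤ = z
  ⟦ e ⊕ f ⟧ℤ = ⟦ e ⟧ℤ ℤ.+ ⟦ f ⟧ℤ
  ⟦ e ⊖ f ⟧ℤ = ⟦ e ⟧ℤ ℤ.- ⟦ f ⟧ℤ
  ⟦ e ⊗ f ⟧ℤ = ⟦ e ⟧ℤ ℤ.* ⟦ f ⟧ℤ

  ⟦_⟧ℚ : Poly → ℚ
  ⟦ ` z ⟧ℚ = ℤ→ℚ z
  ⟦ e ⊕ f ⟧ℚ = ⟦ e ⟧ℚ + ⟦ f ⟧ℚ
  ⟦ e ⊖ f ⟧ℚ = ⟦ e ⟧ℚ - ⟦ f ⟧ℚ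
  ⟦ e ⊗ f ⟧ℚ = ⟦ e ⟧ℚ * ⟦ f ⟧ℚ

  ℤ→ℚ-⟦⟧ : ∀ e → ℤ→ℚ ⟦ e ⟧ℤ ≡ ⟦ e ⟧ℚ
  ℤ→ℚ-⟦⟧ (` z)   = refl
  ℤ→ℚ-⟦⟧ (e ⊕ f) = trans (ℤ→ℚ-homo-+ ⟦ e ⟧ℤ ⟦ f ⟧ℤ) (cong₂ _+_ (ℤ→ℚ-⟦⟧ e) (ℤ→ℚ-⟦⟧ f))
  ℤ→ℚ-⟦⟧ (e ⊖ f) = trans (ℤ→ℚ-homo-− ⟦ e ⟧ℤ ⟦ f ⟧ℤ) (cong₂ _-_ (ℤ→ℚ-⟦⟧ e) (ℤ→ℚ-⟦⟧ f))
  ℤ→ℚ-⟦⟧ (e ⊗ f) = trans (ℤ→ℚ-homo-* ⟦ e ⟧ℤ ⟦ f ⟧ℤ) (cong₂ _*_ (ℤ→ℚ-⟦⟧ e) (ℤ→ℚ-⟦⟧ f))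

  ⟨⟩-cong : ∀ {a a′ b b′ c c′ d d′} → a ≡ a′ → b ≡ b′ → c ≡ c′ → d ≡ d′ →
    ⟨ a , b , c , d ⟩ ≡ ⟨ a′ , b′ , c′ , d′ ⟩
  ⟨⟩-cong refl refl refl refl = refl

  embed : ℍℤ → ℍ
  embed ⟪ a , b , c , d ⟫ = ⟨ ℤ→ℚ a , ℤ→ℚ b , ℤ→ℚ c , ℤ→ℚ d ⟩

  embed-injective : ∀ {v w} → embed v ≡ embed w → v ≡ w
  embed-injective {⟪ _ , _ , _ , _ ⟫} {⟪ _ , _ , _ , _ ⟫} e = cong₄ ⟪_,_,_,_⟫
    (ℤ→ℚ-injective (cong c₁ e)) (ℤ→ℚ-injective (cong c₂ e))
    (ℤ→ℚ-injective (cong c₃ e)) (ℤ→ℚ-injective (cong c₄ e))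
    where
    cong₄ : ∀ {A B C D E : Set} (f : A → B → C → D → E) {a a′ b b′ c c′ d d′} →
      a ≡ a′ → b ≡ b′ → c ≡ c′ → d ≡ d′ → f a b c d ≡ f a′ b′ c′ d′
    cong₄ f refl refl refl refl = refl

  module _ (p : ℕ) where
    private P = + p

    Nrd-embed : ∀ w → Nrd p (embed w) ≡ ℤ→ℚ (nrdℤ p w)
    Nrd-embed ⟪ a₁ , a₂ , a₃ , a₄ ⟫ =
      sym (ℤ→ℚ-⟦⟧ (` a₁ ⊗ ` a₁ ⊕ ` a₂ ⊗ ` a₂ ⊕ ` P ⊗ (` a₃ ⊗ ` a₃) ⊕ ` P ⊗ (` a₄ ⊗ ` a₄)))

    mulH-embed : ∀ v w → mulH p (embed v) (embed w) ≡ embed (mulℤ p v w)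
    mulH-embed ⟪ a₁ , a₂ , a₃ , a₄ ⟫ ⟪ b₁ , b₂ , b₃ , b₄ ⟫ = sym (⟨⟩-cong
      (ℤ→ℚ-⟦⟧ (` a₁ ⊗ ` b₁ ⊖ ` a₂ ⊗ ` b₂ ⊖ ` P ⊗ (` a₃ ⊗ ` b₃) ⊖ ` P ⊗ (` a₄ ⊗ ` b₄)))
      (ℤ→ℚ-⟦⟧ (` a₁ ⊗ ` b₂ ⊕ ` a₂ ⊗ ` b₁ ⊕ ` P ⊗ (` a₃ ⊗ ` b₄ ⊖ ` a₄ ⊗ ` b₃)))
      (ℤ→ℚ-⟦⟧ (` a₁ ⊗ ` b₃ ⊕ ` a₃ ⊗ ` b₁ ⊕ (` a₄ ⊗ ` b₂ ⊖ ` a₂ ⊗ ` b₄)))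
      (ℤ→ℚ-⟦⟧ (` a₁ ⊗ ` b₄ ⊕ ` a₄ ⊗ ` b₁ ⊕ (` a₂ ⊗ ` b₃ ⊖ ` a₃ ⊗ ` b₂))))

  scale-scale : ∀ r s q → scale r (scale s q) ≡ scale (r * s) q
  scale-scale r s ⟨ a₁ , a₂ , a₃ , a₄ ⟩ =
    ⟨⟩-cong (assoc r s a₁) (assoc r s a₂) (assoc r s a₃) (assoc r s a₄)
    where
    assoc : ∀ r s a → r * (s * a) ≡ r * s * a
    assoc = solve-∀ ℚ-ring

  Nrd-scale : ∀ p r q → Nrd p (scale r q) ≡ r * r * Nrd p q
  Nrd-scale p r ⟨ a₁ , a₂ , a₃ , a₄ ⟩ = homogeneous (ℕ→ℚ p) r a₁ a₂ a₃ a₄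
    where
    homogeneous : ∀ P r a₁ a₂ a₃ a₄ →
      r * a₁ * (r * a₁) + r * a₂ * (r * a₂) + P * (r * a₃ * (r * a₃)) + P * (r * a₄ * (r * a₄))
        ≡ r * r * (a₁ * a₁ + a₂ * a₂ + P * (a₃ * a₃) + P * (a₄ * a₄))
    homogeneous = solve-∀ ℚ-ring

  mulH-scale : ∀ p r s q q′ → mulH p (scale r q) (scale s q′) ≡ scale (r * s) (mulH p q q′)
  mulH-scale p r s ⟨ a₁ , a₂ , a₃ , a₄ ⟩ ⟨ b₁ , b₂ , b₃ , b₄ ⟩ = ⟨⟩-cong
    (bilinear₁ (ℕ→ℚ p) r s a₁ a₂ a₃ a₄ b₁ b₂ b₃ b₄)
    (bilinear₂ (ℕ→ℚ p) r s a₁ a₂ a₃ a₄ b₁ b₂ b₃ b₄)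
    (bilinear₃ r s a₁ a₂ a₃ a₄ b₁ b₂ b₃ b₄)
    (bilinear₃ r s a₁ a₃ a₄ a₂ b₁ b₃ b₄ b₂)
    where
    bilinear₁ : ∀ P r s a₁ a₂ a₃ a₄ b₁ b₂ b₃ b₄ →
      r * a₁ * (s * b₁) - r * a₂ * (s * b₂) - P * (r * a₃ * (s * b₃)) - P * (r * a₄ * (s * b₄))
        ≡ r * s * (a₁ * b₁ - a₂ * b₂ - P * (a₃ * b₃) - P * (a₄ * b₄))
    bilinear₁ = solve-∀ ℚ-ring
    bilinear₂ : ∀ P r s a₁ a₂ a₃ a₄ b₁ b₂ b₃ b₄ →
      r * a₁ * (s * b₂) + r * a₂ * (s * b₁) + P * (r * a₃ * (s * b₄) - r * a₄ * (s * b₃))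
        ≡ r * s * (a₁ * b₂ + a₂ * b₁ + P * (a₃ * b₄ - a₄ * b₃))
    bilinear₂ = solve-∀ ℚ-ring
    bilinear₃ : ∀ r s a₁ a₂ a₃ a₄ b₁ b₂ b₃ b₄ →
      r * a₁ * (s * b₃) + r * a₃ * (s * b₁) + (r * a₄ * (s * b₂) - r * a₂ * (s * b₄))
        ≡ r * s * (a₁ * b₃ + a₃ * b₁ + (a₄ * b₂ - a₂ * b₄))
    bilinear₃ = solve-∀ ℚ-ring

  ordElt≡half·double : ∀ a b c d → ordElt a b c d ≡ scale half (embed (double-ordElt a b c d))
  ordElt≡half·double a b c d =
    ⟨⟩-cong (halve a c) (halve b d) (*-comm (ℤ→ℚ c) half) (*-comm (ℤ→ℚ d) half)
    where
    halve : ∀ a c → ℤ→ℚ a + ℤ→ℚ c * half ≡ half * ℤ→ℚ (+ 2 ℤ.* a ℤ.+ c)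
    halve a c = trans (regroup (ℤ→ℚ a) (ℤ→ℚ c)) (cong (half *_) (sym (ℤ→ℚ-⟦⟧ (` + 2 ⊗ ` a ⊕ ` c))))
      where
      regroup : ∀ a c → a + c * half ≡ half * (ℤ→ℚ (+ 2) * a + c)
      regroup = solve-∀ ℚ-ring
    *-comm : ∀ x y → x * y ≡ y * x
    *-comm = solve-∀ ℚ-ring

  ordElt∈ℤ[i] : ∀ a b → ordElt a b 0ℤ 0ℤ ≡ lin1i a b
  ordElt∈ℤ[i] a b = ⟨⟩-cong (drop (ℤ→ℚ a)) (drop (ℤ→ℚ b)) refl refl
    where
    drop : ∀ x → x + ℤ→ℚ 0ℤ * half ≡ x
    drop = solve-∀ ℚ-ring

  ordElt∈ℤj+ℤk : ∀ a b → ordElt a b (ℤ.- (+ 2 ℤ.* a)) (ℤ.- (+ 2 ℤ.* b)) ≡ linjk (ℤ.- a) (ℤ.- b)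
  ordElt∈ℤj+ℤk a b = ⟨⟩-cong (cancel a) (cancel b) (halve a) (halve b)
    where
    -2* : ∀ a → ℤ→ℚ (ℤ.- (+ 2 ℤ.* a)) ≡ - (ℤ→ℚ (+ 2) * ℤ→ℚ a)
    -2* a = trans (ℤ→ℚ-homo‿- (+ 2 ℤ.* a)) (cong -_ (ℤ→ℚ-homo-* (+ 2) a))
    cancel : ∀ a → ℤ→ℚ a + ℤ→ℚ (ℤ.- (+ 2 ℤ.* a)) * half ≡ 0ℚ
    cancel a = trans (cong (λ x → ℤ→ℚ a + x * half) (-2* a)) (identity (ℤ→ℚ a))
      where
      identity : ∀ a → a + - (ℤ→ℚ (+ 2) * a) * half ≡ 0ℚ
      identity = solve-∀ ℚ-ring
    halve : ∀ a → ℤ→ℚ (ℤ.- (+ 2 ℤ.* a)) * half ≡ ℤ→ℚ (ℤ.- a)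
    halve a = trans (cong (_* half) (-2* a)) (trans (identity (ℤ→ℚ a)) (sym (ℤ→ℚ-homo‿- a)))
      where
      identity : ∀ a → - (ℤ→ℚ (+ 2) * a) * half ≡ - a
      identity = solve-∀ ℚ-ring

  inv*half*2ℓ≡1 : ∀ ℓ .{{_ : NonZero ℓ}} → inv ℓ * half * ℤ→ℚ (+ 2 ℤ.* + ℓ) ≡ 1ℚ
  inv*half*2ℓ≡1 ℓ = trans (cong (inv ℓ * half *_) (ℤ→ℚ-homo-* (+ 2) (+ ℓ)))
    (trans (regroup (inv ℓ) (ℤ→ℚ (+ ℓ))) (inv*ℓ≡1 ℓ))
    where
    regroup : ∀ L M → L * half * (ℤ→ℚ (+ 2) * M) ≡ L * M
    regroup = solve-∀ ℚ-ring

  module _ {k : ℚ} {κ : ℤ} (k*κ≡1 : k * ℤ→ℚ κ ≡ 1ℚ) where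
    private K = ℤ→ℚ κ

    cancel-square : ∀ a → K * K * (k * k * a) ≡ a
    cancel-square a = begin
      K * K * (k * k * a)     ≡⟨ regroup k K a ⟩
      k * K * (k * K) * a     ≡⟨ cong (λ x → x * x * a) k*κ≡1 ⟩
      1ℚ * 1ℚ * a             ≡⟨ unit a ⟩
      a                       ∎
      where
      open ≡-Reasoning
      regroup : ∀ k K a → K * K * (k * k * a) ≡ k * K * (k * K) * a
      regroup = solve-∀ ℚ-ring
      unit : ∀ a → 1ℚ * 1ℚ * a ≡ a
      unit = solve-∀ ℚ-ring

    Nrd-clear : ∀ p w → Nrd p (scale k (embed w)) ≡ 1ℚ → nrdℤ p w ≡ κ ℤ.* κ
    Nrd-clear p w e = ℤ→ℚ-injective (begin
      ℤ→ℚ (nrdℤ p w)                    ≡⟨ Nrd-embed p w ⟨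
      Nrd p (embed w)                   ≡⟨ cancel-square (Nrd p (embed w)) ⟨
      K * K * (k * k * Nrd p (embed w)) ≡⟨ cong (K * K *_) (Nrd-scale p k (embed w)) ⟨
      K * K * Nrd p (scale k (embed w)) ≡⟨ cong (K * K *_) e ⟩
      K * K * 1ℚ                        ≡⟨ ℚ.*-identityʳ (K * K) ⟩
      K * K                             ≡⟨ ℤ→ℚ-homo-* κ κ ⟨
      ℤ→ℚ (κ ℤ.* κ)                     ∎)
      where open ≡-Reasoning

    mulH-clear : ∀ p w r → mulH p (scale k (embed w)) (scale k (embed w)) ≡ scalarH (ℤ→ℚ r) →
      mulℤ p w w ≡ ⟪ κ ℤ.* κ ℤ.* r , 0ℤ , 0ℤ , 0ℤ ⟫
    mulH-clear p w r e = embed-injective (begin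
      embed (mulℤ p w w)
        ≡⟨ mulH-embed p w w ⟨
      mulH p (embed w) (embed w)
        ≡⟨ cancel (mulH p (embed w) (embed w)) ⟨
      scale (K * K) (scale (k * k) (mulH p (embed w) (embed w)))
        ≡⟨ cong (scale (K * K)) (mulH-scale p k k (embed w) (embed w)) ⟨
      scale (K * K) (mulH p (scale k (embed w)) (scale k (embed w)))
        ≡⟨ cong (scale (K * K)) e ⟩
      scale (K * K) (scalarH (ℤ→ℚ r))
        ≡⟨ ⟨⟩-cong (sym (ℤ→ℚ-⟦⟧ (` κ ⊗ ` κ ⊗ ` r))) (ℚ.*-zeroʳ (K * K)) (ℚ.*-zeroʳ (K * K)) (ℚ.*-zeroʳ (K * K)) ⟩
      embed ⟪ κ ℤ.* κ ℤ.* r , 0ℤ , 0ℤ , 0ℤ ⟫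
        ∎)
      where
      open ≡-Reasoning
      cancel : ∀ q → scale (K * K) (scale (k * k) q) ≡ q
      cancel ⟨ a₁ , a₂ , a₃ , a₄ ⟩ =
        ⟨⟩-cong (cancel-square a₁) (cancel-square a₂) (cancel-square a₃) (cancel-square a₄)

  scale-ordElt : ∀ r a b c d → scale r (ordElt a b c d) ≡ scale (r * half) (embed (double-ordElt a b c d))
  scale-ordElt r a b c d =
    trans (cong (scale r) (ordElt≡half·double a b c d)) (scale-scale r half (embed (double-ordElt a b c d)))

  Nrd[ℓ⁻¹ordElt]≡1⇒nrdℤ≡4ℓ² : ∀ p ℓ .{{_ : NonZero ℓ}} a b c d →
    Nrd p (scale (inv ℓ) (ordElt a b c d)) ≡ 1ℚ → nrdℤ p (double-ordElt a b c d) ≡ + (4 ℕ.* (ℓ ℕ.* ℓ))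
  Nrd[ℓ⁻¹ordElt]≡1⇒nrdℤ≡4ℓ² p ℓ a b c d e = trans
    (Nrd-clear {k = inv ℓ * half} {κ = + 2 ℤ.* + ℓ} (inv*half*2ℓ≡1 ℓ) p (double-ordElt a b c d)
      (subst (λ μ → Nrd p μ ≡ 1ℚ) (scale-ordElt (inv ℓ) a b c d) e))
    (2ℓ*2ℓ≡4ℓ² ℓ)

  [ℓ⁻¹ordElt]²≡-p⇒mulℤ≡-4ℓ²p : ∀ p ℓ .{{_ : NonZero ℓ}} a b c d →
    let s = scale (inv ℓ) (ordElt a b c d) ; w = double-ordElt a b c d in
    mulH p s s ≡ scalarH (- ℕ→ℚ p) → mulℤ p w w ≡ ⟪ ℤ.- + (4 ℕ.* (ℓ ℕ.* ℓ) ℕ.* p) , 0ℤ , 0ℤ , 0ℤ ⟫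
  [ℓ⁻¹ordElt]²≡-p⇒mulℤ≡-4ℓ²p p ℓ a b c d e = trans
    (mulH-clear {k = inv ℓ * half} {κ = + 2 ℤ.* + ℓ} (inv*half*2ℓ≡1 ℓ) p (double-ordElt a b c d) (ℤ.- + p)
      (subst₂ (λ s r → mulH p s s ≡ scalarH r) (scale-ordElt (inv ℓ) a b c d) (sym (ℤ→ℚ-homo‿- (+ p))) e))
    (cong (λ r → ⟪ r , 0ℤ , 0ℤ , 0ℤ ⟫) (2ℓ*2ℓ*-p≡-4ℓ²p ℓ p))

open import Data.Nat using (ℕ; _<_; _*_; _%_)
open import Data.Nat.Primality using (Prime)
open import Data.Integer using (ℤ; +_) renaming (_+_ to _+ℤ_; _*_ to _*ℤ_)
open import Data.Integer.Divisibility using () renaming (_∣_ to _∣ℤ_)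
open import Data.Rational using (-_)
open import Data.Product using (_×_; ∃)
open import Relation.Binary.PropositionalEquality using (_≡_; _≢_)
open import Relation.Nullary using (¬_)

open IntegerSumsOfTwoSquares using (prime-hypotenuse-cases)
open IntegerQuaternions
open RationalQuaternions
import Data.Integer as ℤ
open import Data.Empty using (⊥-elim)
open import Data.Nat using (NonZero)
open import Data.Nat.Primality using (prime⇒nonZero)
open import Data.Product using (_,_)
import Data.Rational as ℚ
import Data.Rational.Properties as ℚ
open import Data.Sum using (inj₁; inj₂; [_,_]′)
open import Function using (_∘_)
open import Relation.Binary.PropositionalEquality using (refl; trans; cong; cong₂)

norm-one⇒∈ℤ[i] : ∀ {p ℓ} .{{_ : NonZero ℓ}} → 4 * (ℓ * ℓ) < p → ∀ {μ} → InLinvO ℓ μ → Nrd p μ ≡ ℕ→ℚ 1 →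
  ∃ λ x → ∃ λ y → μ ≡ scale (inv ℓ) (lin1i x y) × x *ℤ x +ℤ y *ℤ y ≡ + ℓ *ℤ + ℓ
norm-one⇒∈ℤ[i] {p} {ℓ} bound (a , b , c , d , refl) e =
  let c≡0 , d≡0 , a²+b²≡ℓ² =
        double-ordElt-norm≡4ℓ² p ℓ a b c d bound (Nrd[ℓ⁻¹ordElt]≡1⇒nrdℤ≡4ℓ² p ℓ a b c d e)
  in a , b , cong (scale (inv ℓ)) (trans (cong₂ (ordElt a b) c≡0 d≡0) (ordElt∈ℤ[i] a b)) , a²+b²≡ℓ²

square≡-p⇒∈ℤj+ℤk : ∀ {p ℓ} .{{_ : NonZero ℓ}} → Prime p → 4 * (ℓ * ℓ) < p → ∀ {s} → InLinvO ℓ s →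
  mulH p s s ≡ scalarH (- ℕ→ℚ p) →
  ∃ λ x → ∃ λ y → s ≡ scale (inv ℓ) (linjk x y) × x *ℤ x +ℤ y *ℤ y ≡ + ℓ *ℤ + ℓ
square≡-p⇒∈ℤj+ℤk {p} {ℓ} pp bound (a , b , c , d , refl) e =
  let c≡-2a , d≡-2b , a²+b²≡ℓ² =
        double-ordElt-square≡-4ℓ²p p ℓ a b c d pp bound ([ℓ⁻¹ordElt]²≡-p⇒mulℤ≡-4ℓ²p p ℓ a b c d e)
  in ℤ.- a , ℤ.- b , cong (scale (inv ℓ)) (trans (cong₂ (ordElt a b) c≡-2a d≡-2b) (ordElt∈ℤj+ℤk a b)) , a²+b²≡ℓ²

norm-one-in-ℓ⁻¹O : ∀ {p ℓ} .{{_ : NonZero ℓ}} → Prime ℓ → 4 * (ℓ * ℓ) < p →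
    ((μ : ℍ) → InLinvO ℓ μ → Nrd p μ ≡ ℕ→ℚ 1 →
      μ ≢ qOne → μ ≢ negH qOne → μ ≢ qI → μ ≢ negH qI →
      (ℓ % 4 ≡ 1) × ∃ λ (x : ℤ) → ∃ λ (y : ℤ) →
        (μ ≡ scale (inv ℓ) (lin1i x y)) × ¬ ((+ ℓ) ∣ℤ x) × (x *ℤ x +ℤ y *ℤ y ≡ (+ ℓ) *ℤ (+ ℓ)))
norm-one-in-ℓ⁻¹O {ℓ = ℓ} pℓ bound μ μ∈ e μ≢1 μ≢-1 μ≢i μ≢-i with norm-one⇒∈ℤ[i] bound μ∈ e
... | x , y , μ≡ , x²+y²≡ℓ² with prime-hypotenuse-cases {x = x} {y = y} pℓ x²+y²≡ℓ²
...   | inj₁ (x≡±ℓ , refl) = ⊥-elim ([ μ≢1 ∘ axis , μ≢-1 ∘ axis ]′ (inv*ℓ≡±1 x≡±ℓ))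
  where
  axis : ∀ {v} → inv ℓ ℚ.* ℤ→ℚ x ≡ v → μ ≡ ⟨ v , ℚ.0ℚ , ℚ.0ℚ , ℚ.0ℚ ⟩
  axis e = trans μ≡ (⟨⟩-cong e (ℚ.*-zeroʳ (inv ℓ)) (ℚ.*-zeroʳ (inv ℓ)) (ℚ.*-zeroʳ (inv ℓ)))
...   | inj₂ (inj₁ (refl , y≡±ℓ)) = ⊥-elim ([ μ≢i ∘ axis , μ≢-i ∘ axis ]′ (inv*ℓ≡±1 y≡±ℓ))
  where
  axis : ∀ {v} → inv ℓ ℚ.* ℤ→ℚ y ≡ v → μ ≡ ⟨ ℚ.0ℚ , v , ℚ.0ℚ , ℚ.0ℚ ⟩
  axis e = trans μ≡ (⟨⟩-cong (ℚ.*-zeroʳ (inv ℓ)) e (ℚ.*-zeroʳ (inv ℓ)) (ℚ.*-zeroʳ (inv ℓ)))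
...   | inj₂ (inj₂ (ℓ%4≡1 , ℓ∤x)) = ℓ%4≡1 , x , y , μ≡ , ℓ∤x , x²+y²≡ℓ²

square-root-of-−p-in-ℓ⁻¹O : ∀ {p ℓ} .{{_ : NonZero ℓ}} → Prime p → Prime ℓ → 4 * (ℓ * ℓ) < p →
    ((s : ℍ) → InLinvO ℓ s → mulH p s s ≡ scalarH (- ℕ→ℚ p) →
      s ≢ qJ → s ≢ negH qJ → s ≢ qK → s ≢ negH qK →
      (ℓ % 4 ≡ 1) × ∃ λ (x : ℤ) → ∃ λ (y : ℤ) →
        (s ≡ scale (inv ℓ) (linjk x y)) × ¬ ((+ ℓ) ∣ℤ x) × (x *ℤ x +ℤ y *ℤ y ≡ (+ ℓ) *ℤ (+ ℓ)))
square-root-of-−p-in-ℓ⁻¹O {ℓ = ℓ} pp pℓ bound s s∈ e s≢j s≢-j s≢k s≢-k with square≡-p⇒∈ℤj+ℤk pp bound s∈ e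
... | x , y , s≡ , x²+y²≡ℓ² with prime-hypotenuse-cases {x = x} {y = y} pℓ x²+y²≡ℓ²
...   | inj₁ (x≡±ℓ , refl) = ⊥-elim ([ s≢j ∘ axis , s≢-j ∘ axis ]′ (inv*ℓ≡±1 x≡±ℓ))
  where
  axis : ∀ {v} → inv ℓ ℚ.* ℤ→ℚ x ≡ v → s ≡ ⟨ ℚ.0ℚ , ℚ.0ℚ , v , ℚ.0ℚ ⟩
  axis e = trans s≡ (⟨⟩-cong (ℚ.*-zeroʳ (inv ℓ)) (ℚ.*-zeroʳ (inv ℓ)) e (ℚ.*-zeroʳ (inv ℓ)))
...   | inj₂ (inj₁ (refl , y≡±ℓ)) = ⊥-elim ([ s≢k ∘ axis , s≢-k ∘ axis ]′ (inv*ℓ≡±1 y≡±ℓ))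
  where
  axis : ∀ {v} → inv ℓ ℚ.* ℤ→ℚ y ≡ v → s ≡ ⟨ ℚ.0ℚ , ℚ.0ℚ , ℚ.0ℚ , v ⟩
  axis e = trans s≡ (⟨⟩-cong (ℚ.*-zeroʳ (inv ℓ)) (ℚ.*-zeroʳ (inv ℓ)) (ℚ.*-zeroʳ (inv ℓ)) e)
...   | inj₂ (inj₂ (ℓ%4≡1 , ℓ∤x)) = ℓ%4≡1 , x , y , s≡ , ℓ∤x , x²+y²≡ℓ²

lemma3p3 : (p ℓ : ℕ) → Prime p → p % 4 ≡ 3 → Prime ℓ → 4 * (ℓ * ℓ) < p →
    ((μ : ℍ) → InLinvO ℓ μ → Nrd p μ ≡ ℕ→ℚ 1 →
      μ ≢ qOne → μ ≢ negH qOne → μ ≢ qI → μ ≢ negH qI →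
      (ℓ % 4 ≡ 1) × ∃ λ (x : ℤ) → ∃ λ (y : ℤ) →
        (μ ≡ scale (inv ℓ) (lin1i x y)) × ¬ ((+ ℓ) ∣ℤ x) × (x *ℤ x +ℤ y *ℤ y ≡ (+ ℓ) *ℤ (+ ℓ)))
    × ((s : ℍ) → InLinvO ℓ s → mulH p s s ≡ scalarH (- ℕ→ℚ p) →
      s ≢ qJ → s ≢ negH qJ → s ≢ qK → s ≢ negH qK →
      (ℓ % 4 ≡ 1) × ∃ λ (x : ℤ) → ∃ λ (y : ℤ) →
        (s ≡ scale (inv ℓ) (linjk x y)) × ¬ ((+ ℓ) ∣ℤ x) × (x *ℤ x +ℤ y *ℤ y ≡ (+ ℓ) *ℤ (+ ℓ)))
lemma3p3 p ℓ pp _ pℓ bound = norm-one-in-ℓ⁻¹O pℓ bound , square-root-of-−p-in-ℓ⁻¹O pp pℓ bound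
  where instance _ = prime⇒nonZero pℓ
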